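{- Let $p$ be a prime, $l\in\mathbb{N}$ and $x\in\mathcal{X}_{p^l}$. Let $a=\lfloor p^lx\rfloor$ and suppose $\gcd(a,p)=1=\gcd(a+1,p)$ and $x=\frac{a}{p^l}\oplus\frac{a+1}{p^l}=\frac{2a+1}{2p^l}$. Then $x$ has no best $\mathcal{X}_{p^l}$-approximation other than $x$ itself.
   Context: $\mathcal{X}_{p^l}=\{x/y: x,y\in\mathbb{Z},\ y>0,\ \gcd(x,y)=1,\ p^l\mid y\}\cup\{\infty\}$. For reduced $r_1/s_1,r_2/s_2$, the Farey sum is $\frac{r_1}{s_1}\oplus\frac{r_2}{s_2}=\frac{r_1+r_2}{s_1+s_2}$. An element $u/v\in\mathcal{X}_{p^l}$ (lowest terms, $v>0$) is a best $\mathcal{X}_{p^l}$-approximation of $x\in\mathbb{R}$ if for every $u'/v'\in\mathcal{X}_{p^l}$ different from $u/v$ with $0<v'\le v$ one has $|vx-u|<|v'x-u'|$. -}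

module Defs where

open import Data.Nat as ℕ using (ℕ; _^_; _≤_; _<_)
open import Data.Nat.Divisibility using (_∣_)
open import Data.Nat.Coprimality using (Coprime)
open import Data.Integer as ℤ using (ℤ; +_)
open import Data.Rational as ℚ using (ℚ; ↥_; ↧ₙ_)
open import Data.Product using (_×_)
open import Relation.Binary.PropositionalEquality using (_≡_)
open import Relation.Nullary using (¬_)

ℤtoℚ : ℤ → ℚ
ℤtoℚ z = z ℚ./ 1

ℕtoℚ : ℕ → ℚ
ℕtoℚ n = (+ n) ℚ./ 1

-- The finite part of 𝒳_{p^l}: x ∈ ℚ with p^l dividing its (reduced, positive) denominator.
InX : ℕ → ℕ → ℚ → Set
InX p l x = (p ^ l) ∣ (↧ₙ x)

-- A pair (u , v) represents a finite element u/v of 𝒳_{p^l} written in lowest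
-- terms with v > 0.
IsXFrac : ℕ → ℕ → ℤ → ℕ → Set
IsXFrac p l u v = (0 < v) × Coprime (ℤ.∣ u ∣) v × ((p ^ l) ∣ v)

err : ℚ → ℤ → ℕ → ℚ
err x u v = ℚ.∣ ℕtoℚ v ℚ.* x ℚ.- ℤtoℚ u ∣

IsBestXApprox : ℕ → ℕ → ℚ → ℤ → ℕ → Set
IsBestXApprox p l x u v =
  IsXFrac p l u v ×
  (∀ (u' : ℤ) (v' : ℕ) → IsXFrac p l u' v' → ¬ ((u' ≡ u) × (v' ≡ v)) →
     0 < v' → v' ≤ v → err x u v ℚ.< err x u' v')

-- Write P = p ^ l.  Both a/P and (a+1)/P lie in 𝒳_{p^l} and sit at distance exactly 1/2
-- from x, measured by |P x - c|, so a best approximation u/v (whose denominator v is a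
-- multiple k P with k ≥ 1) must satisfy |v x - u| < 1/2: at least one of the two is a
-- competitor of denominator P ≤ v distinct from u/v.  But v x - u = (k (2a+1) - 2u)/2 is
-- a half-integer, so |v x - u| < 1/2 forces v x = u, i.e. u/v = x.
module Submission where

open import Defs
open import Data.Nat using (ℕ; _*_; _^_)
open import Data.Nat.Primality using (Prime)
open import Data.Nat.Coprimality using (Coprime)
open import Data.Integer as ℤ using (ℤ; +_)
open import Data.Rational as ℚ using (ℚ; ↥_; ↧ₙ_; floor)
open import Data.Product using (_×_)
open import Relation.Binary.PropositionalEquality using (_≡_)

open import Data.Nat as ℕ using (suc; zero)
import Data.Nat.Properties as ℕ
open import Data.Nat.Divisibility using (_∣_; divides; ∣-refl; ∣-trans; ∣⇒≤; >⇒∤)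
import Data.Nat.Coprimality as Coprimality
open import Data.Nat.Primality using (prime⇒nonZero)
import Data.Integer.Properties as ℤ
open import Data.Integer.Tactic.RingSolver using (solve-∀)
open import Data.Rational using (mkℚ; ↧_; toℚᵘ)
import Data.Rational.Properties as ℚ
open import Data.Rational.Unnormalised as ℚᵘ using (mkℚᵘ; *≡*)
import Data.Rational.Unnormalised.Properties as ℚᵘ
open import Data.Product using (∃-syntax; _,_)
open import Relation.Binary.PropositionalEquality using (_≢_; refl; sym; trans; cong; cong₂; subst; module ≡-Reasoning)
open import Relation.Nullary using (¬_; yes; no; contradiction)

coprime-^ʳ : ∀ {m n} → Coprime m n → ∀ k → Coprime m (n ^ k)
coprime-^ʳ {m} _    zero    = Coprimality.sym (Coprimality.1-coprimeTo m)
coprime-^ʳ {n = n} m⊥n (suc k) {i} (i∣m , i∣n*n^k) =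
  coprime-^ʳ m⊥n k (i∣m , Coprimality.coprime-divisor i⊥n i∣n*n^k)
  where
  i⊥n : Coprime i n
  i⊥n (j∣i , j∣n) = m⊥n (∣-trans j∣i i∣m , j∣n)

∣∧<⇒≡0 : ∀ {m n} → n ∣ m → m ℕ.< n → m ≡ 0
∣∧<⇒≡0 {zero}  _   _   = refl
∣∧<⇒≡0 {suc m} n∣m m<n = contradiction n∣m (>⇒∤ m<n)

-- With x = ↥ x / ↧ x one has v x - u = errNumerator x u v / ↧ x.
errNumerator : ℚ → ℤ → ℕ → ℤ
errNumerator x u w = + w ℤ.* ↥ x ℤ.- u ℤ.* ↧ x

toℚᵘ-ℤtoℚ : ∀ z → toℚᵘ (ℤtoℚ z) ≡ mkℚᵘ z 0
toℚᵘ-ℤtoℚ (+ n)      = cong toℚᵘ (ℚ.normalize-coprime (Coprimality.sym (Coprimality.1-coprimeTo n)))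
toℚᵘ-ℤtoℚ ℤ.-[1+ n ] = cong (λ r → toℚᵘ (ℚ.- r)) (ℚ.normalize-coprime (Coprimality.sym (Coprimality.1-coprimeTo (suc n))))

toℚᵘ-err : ∀ n d .(c : Coprime ℤ.∣ n ∣ (suc d)) u w →
           toℚᵘ (err (mkℚ n d c) u w) ℚᵘ.≃ mkℚᵘ (+ ℤ.∣ errNumerator (mkℚ n d c) u w ∣) d
toℚᵘ-err n d c u w = begin
  toℚᵘ ℚ.∣ wx ℚ.- ℤtoℚ u ∣                                   ≈⟨ ℚ.toℚᵘ-homo-∣-∣ (wx ℚ.- ℤtoℚ u) ⟩
  ℚᵘ.∣ toℚᵘ (wx ℚ.- ℤtoℚ u) ∣                                ≈⟨ ℚᵘ.∣-∣-cong homo ⟩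
  ℚᵘ.∣ toℚᵘ (ℕtoℚ w) ℚᵘ.* mkℚᵘ n d ℚᵘ.- toℚᵘ (ℤtoℚ u) ∣      ≡⟨ cong₂ (λ a b → ℚᵘ.∣ a ℚᵘ.* mkℚᵘ n d ℚᵘ.- b ∣) (toℚᵘ-ℤtoℚ (+ w)) (toℚᵘ-ℤtoℚ u) ⟩
  ℚᵘ.∣ mkℚᵘ (+ w) 0 ℚᵘ.* mkℚᵘ n d ℚᵘ.- mkℚᵘ u 0 ∣            ≈⟨ ℚᵘ.∣-∣-cong collect ⟩
  ℚᵘ.∣ mkℚᵘ (errNumerator (mkℚ n d c) u w) d ∣               ∎
  where
  open ℚᵘ.≃-Reasoning
  wx : ℚ
  wx = ℕtoℚ w ℚ.* mkℚ n d c
  homo : toℚᵘ (wx ℚ.- ℤtoℚ u) ℚᵘ.≃ toℚᵘ (ℕtoℚ w) ℚᵘ.* mkℚᵘ n d ℚᵘ.- toℚᵘ (ℤtoℚ u)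
  homo = ℚᵘ.≃-trans (ℚ.toℚᵘ-homo-+ wx (ℚ.- ℤtoℚ u))
           (ℚᵘ.+-cong (ℚ.toℚᵘ-homo-* (ℕtoℚ w) (mkℚ n d c)) (ℚ.toℚᵘ-homo‿- (ℤtoℚ u)))
  normalise : ∀ w n u q → ((w ℤ.* n) ℤ.* + 1 ℤ.+ (ℤ.- u) ℤ.* q) ℤ.* q ≡ (w ℤ.* n ℤ.- u ℤ.* q) ℤ.* (q ℤ.* + 1)
  normalise = solve-∀
  collect : mkℚᵘ (+ w) 0 ℚᵘ.* mkℚᵘ n d ℚᵘ.- mkℚᵘ u 0 ℚᵘ.≃ mkℚᵘ (errNumerator (mkℚ n d c) u w) d
  collect = *≡* (subst (λ q → ((+ w ℤ.* n) ℤ.* + 1 ℤ.+ (ℤ.- u) ℤ.* + q) ℤ.* + suc d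
                                ≡ errNumerator (mkℚ n d c) u w ℤ.* (+ q ℤ.* + 1))
                       (sym (ℕ.*-identityˡ (suc d))) (normalise (+ w) n u (+ suc d)))

err<⇒∣errNumerator∣< : ∀ x {u w u′ w′} → err x u w ℚ.< err x u′ w′ →
                       ℤ.∣ errNumerator x u w ∣ ℕ.< ℤ.∣ errNumerator x u′ w′ ∣
err<⇒∣errNumerator∣< x@(mkℚ n d c) {u} {w} {u′} {w′} lt =
  ℤ.drop‿+<+ (ℤ.*-cancelʳ-<-nonNeg (+ suc d) (ℚᵘ.drop-*<* scaled))
  where
  scaled : mkℚᵘ (+ ℤ.∣ errNumerator x u w ∣) d ℚᵘ.< mkℚᵘ (+ ℤ.∣ errNumerator x u′ w′ ∣) d
  scaled = ℚᵘ.<-respʳ-≃ (toℚᵘ-err n d c u′ w′) (ℚᵘ.<-respˡ-≃ (toℚᵘ-err n d c u w) (ℚ.toℚᵘ-mono-< lt))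

*ℕtoℚ≡ℤtoℚ⇒↥*≡*↧ : ∀ x m z → x ℚ.* ℕtoℚ m ≡ ℤtoℚ z → ↥ x ℤ.* + m ≡ z ℤ.* ↧ x
*ℕtoℚ≡ℤtoℚ⇒↥*≡*↧ x@(mkℚ n d _) m z xm≡z = begin
  n ℤ.* + m              ≡⟨ ℤ.*-identityʳ (n ℤ.* + m) ⟨
  (n ℤ.* + m) ℤ.* + 1    ≡⟨ ℚᵘ.drop-*≡* xm≃z ⟩
  z ℤ.* + (suc d ℕ.* 1)  ≡⟨ cong (λ q → z ℤ.* + q) (ℕ.*-identityʳ (suc d)) ⟩
  z ℤ.* + suc d          ∎
  where
  open ≡-Reasoning
  homo : toℚᵘ (x ℚ.* ℕtoℚ m) ℚᵘ.≃ mkℚᵘ n d ℚᵘ.* mkℚᵘ (+ m) 0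
  homo = ℚᵘ.≃-trans (ℚ.toℚᵘ-homo-* x (ℕtoℚ m)) (ℚᵘ.*-congˡ {mkℚᵘ n d} (ℚᵘ.≃-reflexive (toℚᵘ-ℤtoℚ (+ m))))
  xm≃z : mkℚᵘ n d ℚᵘ.* mkℚᵘ (+ m) 0 ℚᵘ.≃ mkℚᵘ z 0
  xm≃z = ℚᵘ.≃-trans (ℚᵘ.≃-sym homo) (ℚᵘ.≃-reflexive (trans (cong toℚᵘ xm≡z) (toℚᵘ-ℤtoℚ z)))

errNumerator≡0⇒≡ : ∀ x {u v} → 0 ℕ.< v → Coprime ℤ.∣ u ∣ v → errNumerator x u v ≡ + 0 →
                   u ≡ ↥ x × v ≡ ↧ₙ x
errNumerator≡0⇒≡ x {u} {suc v} _ u⊥v vx≡u = cong ↥_ u/v≡x , cong ↧ₙ_ u/v≡x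
  where
  u/v≡x : mkℚ u v u⊥v ≡ x
  u/v≡x = ℚ.≃⇒≡ (ℚ.*≡* (sym (trans (ℤ.*-comm (↥ x) (+ suc v)) (ℤ.i-j≡0⇒i≡j _ _ vx≡u))))

module HalfIntegerPoint (p l : ℕ) (x : ℚ) (a : ℤ)
       (x≡a+½/pˡ : ↥ x ℤ.* + (2 * p ^ l) ≡ (+ 2 ℤ.* a ℤ.+ + 1) ℤ.* ↧ x) where

  P : ℕ
  P = p ^ l

  2*errNumerator-multiple : ∀ k u →
    + 2 ℤ.* errNumerator x u (k * P) ≡ ↧ x ℤ.* (+ k ℤ.* (+ 2 ℤ.* a ℤ.+ + 1) ℤ.- + 2 ℤ.* u)
  2*errNumerator-multiple k u = begin
    + 2 ℤ.* (+ (k * P) ℤ.* ↥ x ℤ.- u ℤ.* ↧ x)                 ≡⟨ cong (λ w → + 2 ℤ.* (w ℤ.* ↥ x ℤ.- u ℤ.* ↧ x)) (ℤ.pos-* k P) ⟩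
    + 2 ℤ.* (+ k ℤ.* + P ℤ.* ↥ x ℤ.- u ℤ.* ↧ x)               ≡⟨ expand (+ k) (+ P) (↥ x) u (↧ x) ⟩
    + k ℤ.* (↥ x ℤ.* (+ 2 ℤ.* + P)) ℤ.- + 2 ℤ.* u ℤ.* ↧ x     ≡⟨ cong (λ t → + k ℤ.* t ℤ.- + 2 ℤ.* u ℤ.* ↧ x) x≡a+½/pˡ′ ⟩
    + k ℤ.* ((+ 2 ℤ.* a ℤ.+ + 1) ℤ.* ↧ x) ℤ.- + 2 ℤ.* u ℤ.* ↧ x ≡⟨ factor (+ k) a u (↧ x) ⟩
    ↧ x ℤ.* (+ k ℤ.* (+ 2 ℤ.* a ℤ.+ + 1) ℤ.- + 2 ℤ.* u)       ∎
    where
    open ≡-Reasoning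
    x≡a+½/pˡ′ : ↥ x ℤ.* (+ 2 ℤ.* + P) ≡ (+ 2 ℤ.* a ℤ.+ + 1) ℤ.* ↧ x
    x≡a+½/pˡ′ = trans (cong (↥ x ℤ.*_) (sym (ℤ.pos-* 2 P))) x≡a+½/pˡ
    expand : ∀ k P n u q → + 2 ℤ.* (k ℤ.* P ℤ.* n ℤ.- u ℤ.* q) ≡ k ℤ.* (n ℤ.* (+ 2 ℤ.* P)) ℤ.- + 2 ℤ.* u ℤ.* q
    expand = solve-∀
    factor : ∀ k a u q → k ℤ.* ((+ 2 ℤ.* a ℤ.+ + 1) ℤ.* q) ℤ.- + 2 ℤ.* u ℤ.* q ≡ q ℤ.* (k ℤ.* (+ 2 ℤ.* a ℤ.+ + 1) ℤ.- + 2 ℤ.* u)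
    factor = solve-∀

  2*∣errNumerator-multiple∣ : ∀ k u →
    2 * ℤ.∣ errNumerator x u (k * P) ∣ ≡ ↧ₙ x * ℤ.∣ + k ℤ.* (+ 2 ℤ.* a ℤ.+ + 1) ℤ.- + 2 ℤ.* u ∣
  2*∣errNumerator-multiple∣ k u = begin
    2 * ℤ.∣ errNumerator x u (k * P) ∣           ≡⟨ ℤ.abs-* (+ 2) (errNumerator x u (k * P)) ⟨
    ℤ.∣ + 2 ℤ.* errNumerator x u (k * P) ∣       ≡⟨ cong ℤ.∣_∣ (2*errNumerator-multiple k u) ⟩
    ℤ.∣ ↧ x ℤ.* (+ k ℤ.* (+ 2 ℤ.* a ℤ.+ + 1) ℤ.- + 2 ℤ.* u) ∣ ≡⟨ ℤ.abs-* (↧ x) (+ k ℤ.* (+ 2 ℤ.* a ℤ.+ + 1) ℤ.- + 2 ℤ.* u) ⟩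
    ↧ₙ x * ℤ.∣ + k ℤ.* (+ 2 ℤ.* a ℤ.+ + 1) ℤ.- + 2 ℤ.* u ∣ ∎
    where open ≡-Reasoning

  ↧∣2*∣errNumerator∣ : ∀ u {w} → P ∣ w → ↧ₙ x ∣ 2 * ℤ.∣ errNumerator x u w ∣
  ↧∣2*∣errNumerator∣ u (divides k refl) =
    divides ∣m∣ (trans (2*∣errNumerator-multiple∣ k u) (ℕ.*-comm (↧ₙ x) ∣m∣))
    where
    ∣m∣ : ℕ
    ∣m∣ = ℤ.∣ + k ℤ.* (+ 2 ℤ.* a ℤ.+ + 1) ℤ.- + 2 ℤ.* u ∣

  2*∣errNumerator∣≡↧ : ∀ c → ℤ.∣ + 1 ℤ.* (+ 2 ℤ.* a ℤ.+ + 1) ℤ.- + 2 ℤ.* c ∣ ≡ 1 →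
                       2 * ℤ.∣ errNumerator x c P ∣ ≡ ↧ₙ x
  2*∣errNumerator∣≡↧ c ∣2a+1-2c∣≡1 = begin
    2 * ℤ.∣ errNumerator x c P ∣        ≡⟨ cong (λ w → 2 * ℤ.∣ errNumerator x c w ∣) (ℕ.*-identityˡ P) ⟨
    2 * ℤ.∣ errNumerator x c (1 * P) ∣  ≡⟨ 2*∣errNumerator-multiple∣ 1 c ⟩
    ↧ₙ x * ℤ.∣ + 1 ℤ.* (+ 2 ℤ.* a ℤ.+ + 1) ℤ.- + 2 ℤ.* c ∣ ≡⟨ cong (↧ₙ x *_) ∣2a+1-2c∣≡1 ⟩
    ↧ₙ x * 1                            ≡⟨ ℕ.*-identityʳ (↧ₙ x) ⟩
    ↧ₙ x                                ∎
    where open ≡-Reasoning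

  Competitor : ℤ → ℕ → Set
  Competitor u v = ∃[ c ] IsXFrac p l c P × ¬ (c ≡ u × P ≡ v) × 2 * ℤ.∣ errNumerator x c P ∣ ≡ ↧ₙ x

  competitor : IsXFrac p l a P → IsXFrac p l (a ℤ.+ + 1) P → ∀ u v → Competitor u v
  competitor a∈X a+1∈X u v with u ℤ.≟ a
  ... | no u≢a  = a , a∈X , (λ (a≡u , _) → u≢a (sym a≡u)) ,
                  2*∣errNumerator∣≡↧ a (cong ℤ.∣_∣ (lowerGap a))
    where
    lowerGap : ∀ a → + 1 ℤ.* (+ 2 ℤ.* a ℤ.+ + 1) ℤ.- + 2 ℤ.* a ≡ + 1
    lowerGap = solve-∀
  ... | yes u≡a = a ℤ.+ + 1 , a+1∈X , (λ (a+1≡u , _) → a+1≢a (trans a+1≡u u≡a)) ,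
                  2*∣errNumerator∣≡↧ (a ℤ.+ + 1) (cong ℤ.∣_∣ (upperGap a))
    where
    upperGap : ∀ a → + 1 ℤ.* (+ 2 ℤ.* a ℤ.+ + 1) ℤ.- + 2 ℤ.* (a ℤ.+ + 1) ≡ ℤ.- + 1
    upperGap = solve-∀
    a+1≢a : a ℤ.+ + 1 ≢ a
    a+1≢a a+1≡a = ℤ.i≢suc[i] (sym (trans (ℤ.+-comm (+ 1) a) a+1≡a))

  best⇒errNumerator≡0 : IsXFrac p l a P → IsXFrac p l (a ℤ.+ + 1) P →
                        ∀ {u v} → IsBestXApprox p l x u v → errNumerator x u v ≡ + 0
  best⇒errNumerator≡0 a∈X a+1∈X {u} {v} ((v>0 , _ , P∣v) , best)
    with competitor a∈X a+1∈X u v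
  ... | c , c∈X@(P>0 , _) , c≢u/v , 2∣e∣≡↧ = ℤ.∣i∣≡0⇒i≡0 ∣e∣≡0
    where
    ∣e∣ : ℕ
    ∣e∣ = ℤ.∣ errNumerator x u v ∣
    2∣e∣<↧ : 2 * ∣e∣ ℕ.< ↧ₙ x
    2∣e∣<↧ = subst (2 * ∣e∣ ℕ.<_) 2∣e∣≡↧
      (ℕ.*-monoʳ-< 2 (err<⇒∣errNumerator∣< x {u} {v} {c} {P} (best c P c∈X c≢u/v P>0 (∣⇒≤ {{ℕ.>-nonZero v>0}} P∣v))))
    ∣e∣≡0 : ∣e∣ ≡ 0
    ∣e∣≡0 = ℕ.*-cancelˡ-≡ ∣e∣ 0 2 (∣∧<⇒≡0 (↧∣2*∣errNumerator∣ u P∣v) 2∣e∣<↧)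

mainTheorem12 : (p l : ℕ) → Prime p → (x : ℚ) → InX p l x →
    let a = floor (ℕtoℚ (p ^ l) ℚ.* x) in
    Coprime (ℤ.∣ a ∣) p → Coprime (ℤ.∣ a ℤ.+ + 1 ∣) p →
    x ℚ.* ℕtoℚ (2 * p ^ l) ≡ ℤtoℚ (+ 2 ℤ.* a ℤ.+ + 1) →
    (u : ℤ) (v : ℕ) → IsBestXApprox p l x u v → (u ≡ ↥ x) × (v ≡ ↧ₙ x)
mainTheorem12 p l p-prime x _ a⊥p a+1⊥p x≡a+½/pˡ u v best@((v>0 , u⊥v , _) , _) =
  errNumerator≡0⇒≡ x v>0 u⊥v (best⇒errNumerator≡0 a∈X a+1∈X best)
  where
  a : ℤ
  a = floor (ℕtoℚ (p ^ l) ℚ.* x)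
  open HalfIntegerPoint p l x a (*ℕtoℚ≡ℤtoℚ⇒↥*≡*↧ x (2 * p ^ l) (+ 2 ℤ.* a ℤ.+ + 1) x≡a+½/pˡ)
  pˡ>0 : 0 ℕ.< p ^ l
  pˡ>0 = ℕ.m^n>0 p {{prime⇒nonZero p-prime}} l
  a∈X : IsXFrac p l a (p ^ l)
  a∈X = pˡ>0 , coprime-^ʳ a⊥p l , ∣-refl
  a+1∈X : IsXFrac p l (a ℤ.+ + 1) (p ^ l)
  a+1∈X = pˡ>0 , coprime-^ʳ a+1⊥p l , ∣-refl
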